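{- For integers $t\ge 1$ and $s\ge \frac{3}{2}t+1$, the graph $\overline{P_s}$ has a pivot-minor isomorphic to $P_t$.
   Context: $P_s$ is the path on $s$ vertices and $\overline{P_s}$ its complement. Local complementation: $G\ast x:=(V(G),E(G)\triangle\{yz:y,z\in N_G(x),y\neq z\})$; pivoting an edge $uv$: $G\wedge uv:=G\ast u\ast v\ast u$; a pivot-minor is obtained by a (possibly empty) sequence of vertex deletions and pivotings. -}

module Defs where

open import Data.Nat using (ℕ; suc; _+_; _*_; _≤_)
open import Data.Fin using (Fin; toℕ; punchIn)
open import Data.Fin.Properties using (_≟_)
open import Data.Bool using (Bool; true; false; _∧_; _xor_; not)
open import Relation.Nullary.Decidable using (⌊_⌋)
open import Relation.Binary.PropositionalEquality using (_≡_)
open import Function.Bundles using (_⤖_; Bijection)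

-- The complement of P_s is symmetric and irreflexive, and local
-- complementation / pivoting / deletion preserve this, so all graphs
-- occurring are simple.

_==_ : ∀ {n} → Fin n → Fin n → Bool
x == y = ⌊ x ≟ y ⌋

pathAdj : ∀ {s} → Fin s → Fin s → Bool
pathAdj i j = ⌊ Data.Nat._≟_ (suc (toℕ i)) (toℕ j) ⌋ Data.Bool.∨ ⌊ Data.Nat._≟_ (suc (toℕ j)) (toℕ i) ⌋
  where import Data.Nat

P-adj : (s : ℕ) → Fin s → Fin s → Bool
P-adj s = pathAdj

coP-adj : (s : ℕ) → Fin s → Fin s → Bool
coP-adj s i j = not (i == j) ∧ not (pathAdj i j)

lc-adj : ∀ {n} → (Fin n → Fin n → Bool) → Fin n → Fin n → Fin n → Bool
lc-adj a x y z = a y z xor (not (y == z) ∧ a x y ∧ a x z)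

pivot-adj : ∀ {n} → (Fin n → Fin n → Bool) → Fin n → Fin n → Fin n → Fin n → Bool
pivot-adj a u v = lc-adj (lc-adj (lc-adj a u) v) u

del-adj : ∀ {n} → (Fin (suc n) → Fin (suc n) → Bool) → Fin (suc n) → Fin n → Fin n → Bool
del-adj a v y z = a (punchIn v y) (punchIn v z)

data PivotMinor : ∀ {m n} → (Fin m → Fin m → Bool) → (Fin n → Fin n → Bool) → Set where
  pm-refl  : ∀ {n} (a : Fin n → Fin n → Bool) → PivotMinor a a
  pm-pivot : ∀ {m n} {h : Fin m → Fin m → Bool} {a : Fin n → Fin n → Bool}
             (u v : Fin n) → a u v ≡ true →
             PivotMinor h (pivot-adj a u v) → PivotMinor h a
  pm-del   : ∀ {m n} {h : Fin m → Fin m → Bool} {a : Fin (suc n) → Fin (suc n) → Bool}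
             (v : Fin (suc n)) →
             PivotMinor h (del-adj a v) → PivotMinor h a

Iso : ∀ {m n} → (Fin m → Fin m → Bool) → (Fin n → Fin n → Bool) → Set
Iso {m} {n} a b = Data.Product.Σ (Fin m ⤖ Fin n) λ f →
  ∀ x y → a x y ≡ b (Bijection.to f x) (Bijection.to f y)
  where import Data.Product

HasPivotMinorIso : ∀ {m n} → (Fin n → Fin n → Bool) → (Fin m → Fin m → Bool) → Set
HasPivotMinorIso {m} {n} g h =
  Data.Product.Σ ℕ λ k → Data.Product.Σ (Fin k → Fin k → Bool) λ a →
    PivotMinor a g Data.Product.× Iso a h
  where import Data.Product

module Submission where

open import Defs
open import Data.Nat using (ℕ; _≤_; _+_; _*_)
open import Data.Nat.Base using (zero; suc; _<_; _∸_; _≡ᵇ_; _<ᵇ_; z≤n; s≤s)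
import Data.Nat.Properties as ℕₚ
open import Data.Nat.Tactic.RingSolver using (solve-∀)
open import Data.Bool using (Bool; true; false; _∧_; _∨_; _xor_; not; if_then_else_)
open import Data.Bool.Properties using (∨-comm; ∧-zeroʳ; xor-identityʳ)
open import Data.Bool.Solver using (module xor-∧-Solver)
open import Data.Fin as Fin using (Fin; toℕ; punchIn; fromℕ<)
import Data.Fin.Properties as Finₚ
open import Data.Product using (Σ; _,_; _×_)
open import Function.Bundles using (mk⇔)
open import Function.Construct.Identity using (⤖-id)
open import Relation.Nullary.Decidable using (yes; no; isYes≗does; dec-true; dec-false; does-⇔)
open import Relation.Nullary.Decidable.Core using (T?)
open import Relation.Binary.PropositionalEquality
open ≡-Reasoning

-- Let Gₐ = glued a be the graph on ℕ in which 0, …, a-1 induce a path,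
-- the vertices from a on induce the complement of the path a – (a+1) – ⋯,
-- and (a-1)a is the only edge between the two parts; so the complement of
-- Pₛ is G₀ on its first s vertices.  By the pivot formula, pivoting the
-- edge (a+1)(a+4) of Gₐ toggles exactly the pairs between {a, a+2} and
-- {a+3, a+5} and the pairs between one of these four vertices and a vertex
-- beyond a+5.  After deleting a+1 and a+4 the path continues through a,
-- a+2, a+3, a+5 and what remains is G_{a+4} again: among the first a + m
-- vertices, six of the complementary part have become four path vertices.
-- Once m ≤ 5, deleting a+1 (if m ≥ 3) extends the path by a and a+2.  The
-- invariant 3t + 2 ≤ 2m + 3a survives each pivot and finally gives t ≤ a,
-- respectively t ≤ a + 2.

Graph : ℕ → Set
Graph n = Fin n → Fin n → Bool

infix 4 _≗₂_
_≗₂_ : ∀ {n} → Graph n → Graph n → Set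
g ≗₂ h = ∀ x y → g x y ≡ h x y

lc-adj-cong : ∀ {n} {g h : Graph n} → g ≗₂ h → ∀ w → lc-adj g w ≗₂ lc-adj h w
lc-adj-cong g≗h w x y =
  cong₂ _xor_ (g≗h x y) (cong (not (x == y) ∧_) (cong₂ _∧_ (g≗h w x) (g≗h w y)))

pivot-adj-cong : ∀ {n} {g h : Graph n} → g ≗₂ h → ∀ u v → pivot-adj g u v ≗₂ pivot-adj h u v
pivot-adj-cong g≗h u v = lc-adj-cong (lc-adj-cong (lc-adj-cong g≗h u) v) u

PivotMinor-resp-≗₂ : ∀ {m n} {a : Graph m} {g h : Graph n} →
  g ≗₂ h → PivotMinor a g → Σ (Graph m) λ b → PivotMinor b h × a ≗₂ b
PivotMinor-resp-≗₂ {h = h} g≗h (pm-refl _) = h , pm-refl h , g≗h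
PivotMinor-resp-≗₂ g≗h (pm-pivot u v uv a≤g)
  with b , b≤h , a≗b ← PivotMinor-resp-≗₂ (pivot-adj-cong g≗h u v) a≤g
  = b , pm-pivot u v (trans (sym (g≗h u v)) uv) b≤h , a≗b
PivotMinor-resp-≗₂ g≗h (pm-del v a≤g)
  with b , b≤h , a≗b ← PivotMinor-resp-≗₂ (λ x y → g≗h (punchIn v x) (punchIn v y)) a≤g
  = b , pm-del v b≤h , a≗b

HasPivotMinorIso-resp-≗₂ : ∀ {m n} {g h : Graph n} {p : Graph m} →
  g ≗₂ h → HasPivotMinorIso g p → HasPivotMinorIso h p
HasPivotMinorIso-resp-≗₂ g≗h (k , a , a≤g , f , a≅p)
  with b , b≤h , a≗b ← PivotMinor-resp-≗₂ g≗h a≤g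
  = k , b , b≤h , f , λ x y → trans (sym (a≗b x y)) (a≅p x y)

HasPivotMinorIso-pivot : ∀ {m n} {g : Graph n} {p : Graph m} (u v : Fin n) → g u v ≡ true →
  HasPivotMinorIso (pivot-adj g u v) p → HasPivotMinorIso g p
HasPivotMinorIso-pivot u v uv (k , a , a≤ , iso) = k , a , pm-pivot u v uv a≤ , iso

HasPivotMinorIso-del : ∀ {m n} {g : Graph (suc n)} {p : Graph m} (v : Fin (suc n)) →
  HasPivotMinorIso (del-adj g v) p → HasPivotMinorIso g p
HasPivotMinorIso-del v (k , a , a≤ , iso) = k , a , pm-del v a≤ , iso

Graphℕ : Set
Graphℕ = ℕ → ℕ → Bool

restrict : ∀ n → Graphℕ → Graph n
restrict n A x y = A (toℕ x) (toℕ y)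

lcℕ : Graphℕ → ℕ → Graphℕ
lcℕ A x y z = A y z xor (not (y ≡ᵇ z) ∧ A x y ∧ A x z)

pivotℕ : Graphℕ → ℕ → ℕ → Graphℕ
pivotℕ A u v = lcℕ (lcℕ (lcℕ A u) v) u

punchInℕ : ℕ → ℕ → ℕ
punchInℕ p i = if i <ᵇ p then i else suc i

pathℕ : Graphℕ
pathℕ i j = (suc i ≡ᵇ j) ∨ (suc j ≡ᵇ i)

coPathℕ : Graphℕ
coPathℕ i j = not (i ≡ᵇ j) ∧ not (pathℕ i j)

≡ᵇ-refl : ∀ n → (n ≡ᵇ n) ≡ true
≡ᵇ-refl n = dec-true (n ℕₚ.≟ n) refl

≢⇒≡ᵇ-false : ∀ {m n} → m ≢ n → (m ≡ᵇ n) ≡ false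
≢⇒≡ᵇ-false {m} {n} = dec-false (m ℕₚ.≟ n)

<⇒<ᵇ-true : ∀ {m n} → m < n → (m <ᵇ n) ≡ true
<⇒<ᵇ-true {m} {n} m<n = dec-true (T? (m <ᵇ n)) (ℕₚ.<⇒<ᵇ m<n)

==-toℕ : ∀ {n} (x y : Fin n) → (x == y) ≡ (toℕ x ≡ᵇ toℕ y)
==-toℕ x y = trans (isYes≗does (x Finₚ.≟ y))
  (does-⇔ (mk⇔ (cong toℕ) Finₚ.toℕ-injective) (x Finₚ.≟ y) (toℕ x ℕₚ.≟ toℕ y))

pathℕ-toℕ : ∀ {t} (x y : Fin t) → pathℕ (toℕ x) (toℕ y) ≡ P-adj t x y
pathℕ-toℕ x y =
  sym (cong₂ _∨_ (isYes≗does (suc (toℕ x) ℕₚ.≟ toℕ y))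
                 (isYes≗does (suc (toℕ y) ℕₚ.≟ toℕ x)))

coPathℕ-toℕ : ∀ {s} (x y : Fin s) → coPathℕ (toℕ x) (toℕ y) ≡ coP-adj s x y
coPathℕ-toℕ x y = cong₂ (λ b c → not b ∧ not c) (sym (==-toℕ x y)) (pathℕ-toℕ x y)

lc-adj-restrict : ∀ {n} {g : Graph n} {A : Graphℕ} → g ≗₂ restrict n A →
  ∀ w → lc-adj g w ≗₂ restrict n (lcℕ A (toℕ w))
lc-adj-restrict g≗A w x y =
  cong₂ _xor_ (g≗A x y) (cong₂ _∧_ (cong not (==-toℕ x y)) (cong₂ _∧_ (g≗A w x) (g≗A w y)))

pivot-adj-restrict : ∀ {n} (A : Graphℕ) (u v : Fin n) →
  pivot-adj (restrict n A) u v ≗₂ restrict n (pivotℕ A (toℕ u) (toℕ v))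
pivot-adj-restrict A u v =
  lc-adj-restrict {A = lcℕ (lcℕ A (toℕ u)) (toℕ v)}
    (lc-adj-restrict {A = lcℕ A (toℕ u)} (lc-adj-restrict {A = A} (λ _ _ → refl) u) v) u

punchInℕ-suc : ∀ p i → punchInℕ (suc p) (suc i) ≡ suc (punchInℕ p i)
punchInℕ-suc p i with i <ᵇ p
... | true  = refl
... | false = refl

punchInℕ-below : ∀ {p i} → i < p → punchInℕ p i ≡ i
punchInℕ-below i<p rewrite <⇒<ᵇ-true i<p = refl

punchInℕ-shift : ∀ a p i → punchInℕ (a + p) (a + i) ≡ a + punchInℕ p i
punchInℕ-shift zero    p i = refl
punchInℕ-shift (suc a) p i =
  trans (punchInℕ-suc (a + p) (a + i)) (cong suc (punchInℕ-shift a p i))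

toℕ-punchIn : ∀ {n} (v : Fin (suc n)) (x : Fin n) →
  toℕ (punchIn v x) ≡ punchInℕ (toℕ v) (toℕ x)
toℕ-punchIn Fin.zero    x           = refl
toℕ-punchIn (Fin.suc v) Fin.zero    = refl
toℕ-punchIn (Fin.suc v) (Fin.suc x) =
  trans (cong suc (toℕ-punchIn v x)) (sym (punchInℕ-suc (toℕ v) (toℕ x)))

HasPathMinor : ℕ → ℕ → Graphℕ → Set
HasPathMinor t n A = HasPivotMinorIso (restrict n A) (P-adj t)

HasPathMinor-resp : ∀ {t n} {A B : Graphℕ} → (∀ i j → i < n → j < n → A i j ≡ B i j) →
  HasPathMinor t n A → HasPathMinor t n B
HasPathMinor-resp {t} A≈B =
  HasPivotMinorIso-resp-≗₂ {p = P-adj t} λ x y →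
    A≈B (toℕ x) (toℕ y) (Finₚ.toℕ<n x) (Finₚ.toℕ<n y)

HasPathMinor-pivot : ∀ {t n u v} {A : Graphℕ} → u < n → v < n → A u v ≡ true →
  HasPathMinor t n (pivotℕ A u v) → HasPathMinor t n A
HasPathMinor-pivot {t} {n} {A = A} u<n v<n uv h =
  HasPivotMinorIso-pivot {p = P-adj t} u′ v′
    (subst₂ (λ p q → A p q ≡ true) (sym toℕ-u′) (sym toℕ-v′) uv)
    (HasPivotMinorIso-resp-≗₂ {p = P-adj t} (λ x y → sym (pivot-adj-restrict A u′ v′ x y))
      (subst₂ (λ p q → HasPathMinor t n (pivotℕ A p q)) (sym toℕ-u′) (sym toℕ-v′) h))
  where
  u′ = fromℕ< u<n
  v′ = fromℕ< v<n
  toℕ-u′ = Finₚ.toℕ-fromℕ< u<n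
  toℕ-v′ = Finₚ.toℕ-fromℕ< v<n

HasPathMinor-delete : ∀ {t n p} {A : Graphℕ} → p < suc n →
  HasPathMinor t n (λ i j → A (punchInℕ p i) (punchInℕ p j)) → HasPathMinor t (suc n) A
HasPathMinor-delete {t} {p = p} {A} p<1+n h =
  HasPivotMinorIso-del {p = P-adj t} v
    (HasPivotMinorIso-resp-≗₂ {p = P-adj t}
      (λ x y → cong₂ A (sym (toℕ-punchIn-v x)) (sym (toℕ-punchIn-v y))) h)
  where
  v = fromℕ< p<1+n
  toℕ-punchIn-v : ∀ x → toℕ (punchIn v x) ≡ punchInℕ p (toℕ x)
  toℕ-punchIn-v x =
    trans (toℕ-punchIn v x) (cong (λ q → punchInℕ q (toℕ x)) (Finₚ.toℕ-fromℕ< p<1+n))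

HasPathMinor-prefix : ∀ {t n} {A : Graphℕ} → t ≤ n →
  (∀ i j → i < t → j < t → A i j ≡ pathℕ i j) → HasPathMinor t n A
HasPathMinor-prefix {t} {n} {A} t≤n A≈path =
  subst (λ k → HasPathMinor t k A) (ℕₚ.m∸n+n≡m t≤n) (deleteTop (n ∸ t))
  where
  deleteTop : ∀ d → HasPathMinor t (d + t) A
  deleteTop zero = t , restrict t A , pm-refl _ , ⤖-id (Fin t) , λ x y →
    trans (A≈path (toℕ x) (toℕ y) (Finₚ.toℕ<n x) (Finₚ.toℕ<n y)) (pathℕ-toℕ x y)
  deleteTop (suc d) = HasPathMinor-delete {A = A} (ℕₚ.n<1+n (d + t)) (HasPathMinor-resp
    (λ i j i< j< → sym (cong₂ A (punchInℕ-below i<) (punchInℕ-below j<))) (deleteTop d))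

lcℕ-outsideˡ : ∀ A x y z → A x y ≡ false → lcℕ A x y z ≡ A y z
lcℕ-outsideˡ A x y z xy rewrite xy | ∧-zeroʳ (not (y ≡ᵇ z)) = xor-identityʳ (A y z)

lcℕ-outsideʳ : ∀ A x y z → A x z ≡ false → lcℕ A x y z ≡ A y z
lcℕ-outsideʳ A x y z xz rewrite xz | ∧-zeroʳ (A x y) | ∧-zeroʳ (not (y ≡ᵇ z)) =
  xor-identityʳ (A y z)

lcℕ-diag : ∀ A x y → lcℕ A x y y ≡ A y y
lcℕ-diag A x y rewrite ≡ᵇ-refl y = xor-identityʳ (A y y)

pivotℕ-diag : ∀ A u v y → pivotℕ A u v y y ≡ A y y
pivotℕ-diag A u v y =
  trans (lcℕ-diag (lcℕ (lcℕ A u) v) u y) (trans (lcℕ-diag (lcℕ A u) v y) (lcℕ-diag A u y))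

module _ (A : Graphℕ) (u v y : ℕ) (uy : A u y ≡ false) (vy : A v y ≡ false) where

  private
    vy₁ : lcℕ A u v y ≡ false
    vy₁ = trans (lcℕ-outsideʳ A u v y uy) vy

    uy₂ : lcℕ (lcℕ A u) v u y ≡ false
    uy₂ = trans (lcℕ-outsideʳ (lcℕ A u) v u y vy₁) (trans (lcℕ-outsideʳ A u u y uy) uy)

  pivotℕ-outsideˡ : ∀ z → pivotℕ A u v y z ≡ A y z
  pivotℕ-outsideˡ z = trans (lcℕ-outsideˡ (lcℕ (lcℕ A u) v) u y z uy₂)
    (trans (lcℕ-outsideˡ (lcℕ A u) v y z vy₁) (lcℕ-outsideˡ A u y z uy))

  pivotℕ-outsideʳ : ∀ z → pivotℕ A u v z y ≡ A z y
  pivotℕ-outsideʳ z = trans (lcℕ-outsideʳ (lcℕ (lcℕ A u) v) u z y uy₂)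
    (trans (lcℕ-outsideʳ (lcℕ A u) v z y vy₁) (lcℕ-outsideʳ A u z y uy))

lcℕ-distinct : ∀ A x y z → (y ≡ᵇ z) ≡ false → lcℕ A x y z ≡ A y z xor (A x y ∧ A x z)
lcℕ-distinct A x y z yz rewrite yz = refl

pivotℕ-formula : ∀ A u v y z →
  (y ≡ᵇ z) ≡ false → (u ≡ᵇ y) ≡ false → (u ≡ᵇ z) ≡ false →
  (v ≡ᵇ y) ≡ false → (v ≡ᵇ z) ≡ false → (v ≡ᵇ u) ≡ false →
  A u u ≡ false → A u v ≡ true → A v u ≡ true →
  pivotℕ A u v y z ≡ A y z xor ((A u y ∧ A v z) xor (A v y ∧ A u z))
pivotℕ-formula A u v y z yz uy uz vy vz vu uu uv vu′ = begin
  lcℕ A₂ u y z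
    ≡⟨ lcℕ-distinct A₂ u y z yz ⟩
  A₂ y z xor (A₂ u y ∧ A₂ u z)
    ≡⟨ cong₂ _xor_ A₂-yz (cong₂ _∧_ (A₂-u uy vy) (A₂-u uz vz)) ⟩
  ((A y z xor (A u y ∧ A u z)) xor ((A v y xor A u y) ∧ (A v z xor A u z))) xor
    ((A u y xor (A v y xor A u y)) ∧ (A u z xor (A v z xor A u z)))
    ≡⟨ toggles (A y z) (A u y) (A u z) (A v y) (A v z) ⟩
  A y z xor ((A u y ∧ A v z) xor (A v y ∧ A u z)) ∎
  where
  A₁ = lcℕ A u
  A₂ = lcℕ A₁ v

  A₁-v : ∀ {w} → (v ≡ᵇ w) ≡ false → A₁ v w ≡ A v w xor A u w
  A₁-v {w} vw = trans (lcℕ-distinct A u v w vw) (cong (λ b → A v w xor (b ∧ A u w)) uv)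

  A₁-u : ∀ {w} → (u ≡ᵇ w) ≡ false → A₁ u w ≡ A u w
  A₁-u {w} uw = trans (lcℕ-distinct A u u w uw)
    (trans (cong (λ b → A u w xor (b ∧ A u w)) uu) (xor-identityʳ (A u w)))

  A₂-yz : A₂ y z ≡ (A y z xor (A u y ∧ A u z)) xor ((A v y xor A u y) ∧ (A v z xor A u z))
  A₂-yz = trans (lcℕ-distinct A₁ v y z yz)
    (cong₂ _xor_ (lcℕ-distinct A u y z yz) (cong₂ _∧_ (A₁-v vy) (A₁-v vz)))

  A₂-u : ∀ {w} → (u ≡ᵇ w) ≡ false → (v ≡ᵇ w) ≡ false →
    A₂ u w ≡ A u w xor (A v w xor A u w)
  A₂-u {w} uw vw =
    trans (lcℕ-distinct A₁ v u w uw) (cong₂ _xor_ (A₁-u uw) (cong₂ _∧_ A₁-vu (A₁-v vw)))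
    where
    A₁-vu : A₁ v u ≡ true
    A₁-vu = trans (A₁-v vu) (cong₂ _xor_ vu′ uu)

  toggles : ∀ ayz auy auz avy avz →
    ((ayz xor (auy ∧ auz)) xor ((avy xor auy) ∧ (avz xor auz))) xor
      ((auy xor (avy xor auy)) ∧ (auz xor (avz xor auz)))
    ≡ ayz xor ((auy ∧ avz) xor (avy ∧ auz))
  toggles = solve 5 (λ yz uy uz vy vz →
    ((yz :+ uy :* uz) :+ (vy :+ uy) :* (vz :+ uz)) :+ (uy :+ (vy :+ uy)) :* (uz :+ (vz :+ uz))
    := yz :+ (uy :* vz :+ vy :* uz)) refl
    where open xor-∧-Solver

glued : ℕ → Graphℕ
glued a i j = if (i <ᵇ a) ∨ (j <ᵇ a) then pathℕ i j else coPathℕ i j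

glued-shift : ∀ a c x y → glued (a + c) (a + x) (a + y) ≡ glued c x y
glued-shift zero    c x y = refl
glued-shift (suc a) c x y = glued-shift a c x y

glued-shift₀ : ∀ a x y → glued a (a + x) (a + y) ≡ glued 0 x y
glued-shift₀ zero    x y = refl
glued-shift₀ (suc a) x y = glued-shift₀ a x y

pathℕ-shift : ∀ a x y → pathℕ (a + x) (a + y) ≡ pathℕ x y
pathℕ-shift zero    x y = refl
pathℕ-shift (suc a) x y = pathℕ-shift a x y

pathℕ-sym : ∀ x y → pathℕ x y ≡ pathℕ y x
pathℕ-sym x y = ∨-comm (suc x ≡ᵇ y) (suc y ≡ᵇ x)

glued-belowˡ : ∀ {i a} → i < a → ∀ j → glued a i j ≡ pathℕ i j
glued-belowˡ i<a j rewrite <⇒<ᵇ-true i<a = refl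

glued-belowʳ : ∀ {j a} → j < a → ∀ i → glued a i j ≡ pathℕ i j
glued-belowʳ {j} {a} j<a i rewrite <⇒<ᵇ-true j<a with i <ᵇ a
... | true  = refl
... | false = refl

pathℕ-across : ∀ {i a} → i < a → ∀ r → pathℕ i (a + suc r) ≡ false
pathℕ-across {i} {a} i<a r = cong₂ _∨_
  (≢⇒≡ᵇ-false λ eq → ℕₚ.<-irrefl eq (ℕₚ.≤-<-trans i<a (ℕₚ.m<m+n a (s≤s z≤n))))
  (≢⇒≡ᵇ-false λ eq → ℕₚ.<-irrefl (sym eq) (ℕₚ.<-trans i<a (s≤s (ℕₚ.m≤m+n a (suc r)))))

pathℕ-punchIn-across : ∀ {i a} → i < a → ∀ p r →
  pathℕ i (a + punchInℕ (suc p) r) ≡ pathℕ i (a + r)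
pathℕ-punchIn-across i<a p zero    = refl
pathℕ-punchIn-across {i} {a} i<a p (suc r) = begin
  pathℕ i (a + punchInℕ (suc p) (suc r)) ≡⟨ cong (λ x → pathℕ i (a + x)) (punchInℕ-suc p r) ⟩
  pathℕ i (a + suc (punchInℕ p r))       ≡⟨ pathℕ-across i<a (punchInℕ p r) ⟩
  false                                  ≡⟨ pathℕ-across i<a r ⟨
  pathℕ i (a + suc r)                    ∎

data Split (a : ℕ) : ℕ → Set where
  below : ∀ {i} → i < a → Split a i
  above : ∀ q → Split a (a + q)

split : ∀ a i → Split a i
split zero    i       = above i
split (suc a) zero    = below (s≤s z≤n)
split (suc a) (suc i) with split a i
... | below i<a = below (s≤s i<a)
... | above q   = above q

<-+1 : ∀ {i a} → i < a → i < a + 1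
<-+1 {a = a} i<a = ℕₚ.≤-trans i<a (ℕₚ.m≤m+n a 1)

<-+4 : ∀ {i a} → i < a → i < a + 4
<-+4 {a = a} i<a = ℕₚ.≤-trans i<a (ℕₚ.m≤m+n a 4)

survivor : ℕ → ℕ → ℕ
survivor a i = punchInℕ (a + 4) (punchInℕ (a + 1) i)

survivor-below : ∀ {a i} → i < a → survivor a i ≡ i
survivor-below {a} i<a =
  trans (cong (punchInℕ (a + 4)) (punchInℕ-below (<-+1 i<a))) (punchInℕ-below (<-+4 i<a))

survivor-above : ∀ a q → survivor a (a + q) ≡ a + survivor 0 q
survivor-above a q =
  trans (cong (punchInℕ (a + 4)) (punchInℕ-shift a 1 q)) (punchInℕ-shift a 4 (punchInℕ 1 q))

pathℕ-survivor-across : ∀ {i a} → i < a → ∀ r → pathℕ i (a + survivor 0 r) ≡ pathℕ i (a + r)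
pathℕ-survivor-across i<a r =
  trans (pathℕ-punchIn-across i<a 3 (punchInℕ 1 r)) (pathℕ-punchIn-across i<a 0 r)

pivoted : ℕ → Graphℕ
pivoted a = pivotℕ (glued a) (a + 1) (a + 4)

pivoted-shift : ∀ a y z → pivoted a (a + y) (a + z) ≡ pivoted 0 y z
pivoted-shift zero    y z = refl
pivoted-shift (suc a) y z = pivoted-shift a y z

-- Vertices 0, …, 3 and 4 + k of G₄ are 0, 2, 3, 5 and 6 + k of G₀; pairs
-- involving one of the first four are computed, the others follow from the
-- pivot formula.
pivoted₀-survivor : ∀ q r → pivoted 0 (survivor 0 q) (survivor 0 r) ≡ glued 4 q r
pivoted₀-survivor 0 0 = refl
pivoted₀-survivor 0 1 = refl
pivoted₀-survivor 0 2 = refl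
pivoted₀-survivor 0 3 = refl
pivoted₀-survivor 0 (suc (suc (suc (suc r)))) = refl
pivoted₀-survivor 1 0 = refl
pivoted₀-survivor 1 1 = refl
pivoted₀-survivor 1 2 = refl
pivoted₀-survivor 1 3 = refl
pivoted₀-survivor 1 (suc (suc (suc (suc r)))) = refl
pivoted₀-survivor 2 0 = refl
pivoted₀-survivor 2 1 = refl
pivoted₀-survivor 2 2 = refl
pivoted₀-survivor 2 3 = refl
pivoted₀-survivor 2 (suc (suc (suc (suc r)))) = refl
pivoted₀-survivor 3 0 = refl
pivoted₀-survivor 3 1 = refl
pivoted₀-survivor 3 2 = refl
pivoted₀-survivor 3 3 = refl
pivoted₀-survivor 3 4 = refl
pivoted₀-survivor 3 (suc (suc (suc (suc (suc r))))) = refl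
pivoted₀-survivor (suc (suc (suc (suc q)))) 0 = refl
pivoted₀-survivor (suc (suc (suc (suc q)))) 1 = refl
pivoted₀-survivor (suc (suc (suc (suc q)))) 2 = refl
pivoted₀-survivor 4 3 = refl
pivoted₀-survivor (suc (suc (suc (suc (suc q))))) 3 = refl
pivoted₀-survivor (suc (suc (suc (suc q)))) (suc (suc (suc (suc r)))) with q ℕₚ.≟ r
... | yes refl = pivotℕ-diag (glued 0) 1 4 (6 + q)
... | no  q≢r  = trans (pivotℕ-formula (glued 0) 1 4 (6 + q) (6 + r)
  (≢⇒≡ᵇ-false q≢r) refl refl refl refl refl refl refl refl) (xor-identityʳ _)

module _ {a i : ℕ} (i<a : i < a) where

  private
    pivot-nonadjacent : ∀ w → glued a (a + suc w) i ≡ false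
    pivot-nonadjacent w =
      trans (glued-belowʳ i<a (a + suc w)) (trans (pathℕ-sym _ i) (pathℕ-across i<a w))

  pivoted-belowˡ : ∀ z → pivoted a i z ≡ glued a i z
  pivoted-belowˡ =
    pivotℕ-outsideˡ (glued a) (a + 1) (a + 4) i (pivot-nonadjacent 0) (pivot-nonadjacent 3)

  pivoted-belowʳ : ∀ z → pivoted a z i ≡ glued a z i
  pivoted-belowʳ =
    pivotℕ-outsideʳ (glued a) (a + 1) (a + 4) i (pivot-nonadjacent 0) (pivot-nonadjacent 3)

pivoted-survivor : ∀ a i j → pivoted a (survivor a i) (survivor a j) ≡ glued (a + 4) i j
pivoted-survivor a i j with split a i | split a j
... | below i<a | below j<a = begin
  pivoted a (survivor a i) (survivor a j)
    ≡⟨ cong₂ (pivoted a) (survivor-below i<a) (survivor-below j<a) ⟩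
  pivoted a i j        ≡⟨ pivoted-belowˡ i<a j ⟩
  glued a i j          ≡⟨ glued-belowˡ i<a j ⟩
  pathℕ i j            ≡⟨ glued-belowˡ (<-+4 i<a) j ⟨
  glued (a + 4) i j    ∎
... | below i<a | above r = begin
  pivoted a (survivor a i) (survivor a (a + r))
    ≡⟨ cong₂ (pivoted a) (survivor-below i<a) (survivor-above a r) ⟩
  pivoted a i (a + survivor 0 r) ≡⟨ pivoted-belowˡ i<a _ ⟩
  glued a i (a + survivor 0 r)   ≡⟨ glued-belowˡ i<a _ ⟩
  pathℕ i (a + survivor 0 r)     ≡⟨ pathℕ-survivor-across i<a r ⟩
  pathℕ i (a + r)                ≡⟨ glued-belowˡ (<-+4 i<a) _ ⟨
  glued (a + 4) i (a + r)        ∎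
... | above q | below j<a = begin
  pivoted a (survivor a (a + q)) (survivor a j)
    ≡⟨ cong₂ (pivoted a) (survivor-above a q) (survivor-below j<a) ⟩
  pivoted a (a + survivor 0 q) j ≡⟨ pivoted-belowʳ j<a _ ⟩
  glued a (a + survivor 0 q) j   ≡⟨ glued-belowʳ j<a _ ⟩
  pathℕ (a + survivor 0 q) j     ≡⟨ pathℕ-sym _ j ⟩
  pathℕ j (a + survivor 0 q)     ≡⟨ pathℕ-survivor-across j<a q ⟩
  pathℕ j (a + q)                ≡⟨ pathℕ-sym _ j ⟨
  pathℕ (a + q) j                ≡⟨ glued-belowʳ (<-+4 j<a) _ ⟨
  glued (a + 4) (a + q) j        ∎
... | above q | above r = begin
  pivoted a (survivor a (a + q)) (survivor a (a + r))
    ≡⟨ cong₂ (pivoted a) (survivor-above a q) (survivor-above a r) ⟩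
  pivoted a (a + survivor 0 q) (a + survivor 0 r)
    ≡⟨ pivoted-shift a _ _ ⟩
  pivoted 0 (survivor 0 q) (survivor 0 r)
    ≡⟨ pivoted₀-survivor q r ⟩
  glued 4 q r
    ≡⟨ glued-shift a 4 q r ⟨
  glued (a + 4) (a + q) (a + r) ∎

glued-step : ∀ {t} a m →
  HasPathMinor t (a + 4 + m) (glued (a + 4)) → HasPathMinor t (a + (6 + m)) (glued a)
glued-step {t} a m h =
  subst (λ n → HasPathMinor t n (glued a)) (sym (size a m))
    (HasPathMinor-pivot {A = glued a} (ℕₚ.m<n⇒m<1+n a+1<) a+4< (glued-shift₀ a 1 4)
      (HasPathMinor-delete {A = pivoted a} a+4<
        (HasPathMinor-delete {A = λ i j → pivoted a (punchInℕ (a + 4) i) (punchInℕ (a + 4) j)} a+1<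
          (HasPathMinor-resp (λ i j _ _ → sym (pivoted-survivor a i j)) h))))
  where
  size : ∀ a m → a + (6 + m) ≡ suc (suc (a + 4 + m))
  size = solve-∀
  a+4≤ : a + 4 ≤ a + 4 + m
  a+4≤ = ℕₚ.m≤m+n (a + 4) m
  a+1< : a + 1 < suc (a + 4 + m)
  a+1< = s≤s (ℕₚ.≤-trans (ℕₚ.+-monoʳ-≤ a (s≤s z≤n)) a+4≤)
  a+4< : a + 4 < suc (suc (a + 4 + m))
  a+4< = s≤s (ℕₚ.≤-trans a+4≤ (ℕₚ.n≤1+n _))

glued-short : ∀ {t a} m → t ≤ a → HasPathMinor t (a + m) (glued a)
glued-short {a = a} m t≤a = HasPathMinor-prefix (ℕₚ.≤-trans t≤a (ℕₚ.m≤m+n a m))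
  (λ i j i<t _ → glued-belowˡ (ℕₚ.<-≤-trans i<t t≤a) j)

glued₀-drop : ∀ q r → q < 2 → r < 2 → glued 0 (punchInℕ 1 q) (punchInℕ 1 r) ≡ pathℕ q r
glued₀-drop 0 0 _ _ = refl
glued₀-drop 0 1 _ _ = refl
glued₀-drop 1 0 _ _ = refl
glued₀-drop 1 1 _ _ = refl
glued₀-drop (suc (suc _)) _ (s≤s (s≤s ())) _
glued₀-drop _ (suc (suc _)) _ (s≤s (s≤s ()))

glued-drop-prefix : ∀ a i j → i < 2 + a → j < 2 + a →
  glued a (punchInℕ (a + 1) i) (punchInℕ (a + 1) j) ≡ pathℕ i j
glued-drop-prefix a i j i<2+a j<2+a with split a i | split a j
... | below i<a | below j<a = begin
  glued a (punchInℕ (a + 1) i) (punchInℕ (a + 1) j)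
    ≡⟨ cong₂ (glued a) (punchInℕ-below (<-+1 i<a)) (punchInℕ-below (<-+1 j<a)) ⟩
  glued a i j ≡⟨ glued-belowˡ i<a j ⟩
  pathℕ i j   ∎
... | below i<a | above r = begin
  glued a (punchInℕ (a + 1) i) (punchInℕ (a + 1) (a + r))
    ≡⟨ cong₂ (glued a) (punchInℕ-below (<-+1 i<a)) (punchInℕ-shift a 1 r) ⟩
  glued a i (a + punchInℕ 1 r) ≡⟨ glued-belowˡ i<a _ ⟩
  pathℕ i (a + punchInℕ 1 r)   ≡⟨ pathℕ-punchIn-across i<a 0 r ⟩
  pathℕ i (a + r)              ∎
... | above q | below j<a = begin
  glued a (punchInℕ (a + 1) (a + q)) (punchInℕ (a + 1) j)
    ≡⟨ cong₂ (glued a) (punchInℕ-shift a 1 q) (punchInℕ-below (<-+1 j<a)) ⟩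
  glued a (a + punchInℕ 1 q) j ≡⟨ glued-belowʳ j<a _ ⟩
  pathℕ (a + punchInℕ 1 q) j   ≡⟨ pathℕ-sym _ j ⟩
  pathℕ j (a + punchInℕ 1 q)   ≡⟨ pathℕ-punchIn-across j<a 0 q ⟩
  pathℕ j (a + q)              ≡⟨ pathℕ-sym _ j ⟨
  pathℕ (a + q) j              ∎
... | above q | above r = begin
  glued a (punchInℕ (a + 1) (a + q)) (punchInℕ (a + 1) (a + r))
    ≡⟨ cong₂ (glued a) (punchInℕ-shift a 1 q) (punchInℕ-shift a 1 r) ⟩
  glued a (a + punchInℕ 1 q) (a + punchInℕ 1 r)
    ≡⟨ glued-shift₀ a _ _ ⟩
  glued 0 (punchInℕ 1 q) (punchInℕ 1 r)
    ≡⟨ glued₀-drop q r (cancel i<2+a) (cancel j<2+a) ⟩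
  pathℕ q r
    ≡⟨ pathℕ-shift a q r ⟨
  pathℕ (a + q) (a + r) ∎
  where
  cancel : ∀ {x} → a + x < 2 + a → x < 2
  cancel {x} h = ℕₚ.+-cancelˡ-< a x 2 (subst (a + x <_) (ℕₚ.+-comm 2 a) h)

glued-drop : ∀ {t a} m → t ≤ 2 + a → HasPathMinor t (a + (3 + m)) (glued a)
glued-drop {t} {a} m t≤2+a =
  subst (λ n → HasPathMinor t n (glued a)) (sym (ℕₚ.+-suc a (2 + m)))
    (HasPathMinor-delete {A = glued a} (s≤s (ℕₚ.+-monoʳ-≤ a (s≤s z≤n)))
      (HasPathMinor-prefix (ℕₚ.≤-trans t≤2+a 2+a≤)
        (λ i j i<t j<t →
          glued-drop-prefix a i j (ℕₚ.<-≤-trans i<t t≤2+a) (ℕₚ.<-≤-trans j<t t≤2+a))))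
  where
  2+a≤ : 2 + a ≤ a + (2 + m)
  2+a≤ = ℕₚ.≤-trans (ℕₚ.≤-reflexive (ℕₚ.+-comm 2 a)) (ℕₚ.+-monoʳ-≤ a (ℕₚ.m≤m+n 2 m))

path-length-bound : ∀ t a b c → 3 * t + 2 ≤ c + 3 * a → c ≤ 3 * b + 4 → t ≤ b + a
path-length-bound t a b c h c≤ = ℕₚ.≮⇒≥ λ b+a<t →
  ℕₚ.<-irrefl refl (subst (_≤ 3 * b + 4 + 3 * a) (expand a b)
    (ℕₚ.≤-trans (ℕₚ.+-monoˡ-≤ 2 (ℕₚ.*-monoʳ-≤ 3 b+a<t))
      (ℕₚ.≤-trans h (ℕₚ.+-monoˡ-≤ (3 * a) c≤))))
  where
  expand : ∀ a b → 3 * suc (b + a) + 2 ≡ suc (3 * b + 4 + 3 * a)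
  expand = solve-∀

glued-hasPathMinor : ∀ m a t → 3 * t + 2 ≤ 2 * m + 3 * a → HasPathMinor t (a + m) (glued a)
glued-hasPathMinor 0 a t h = glued-short 0 (path-length-bound t a 0 0 h z≤n)
glued-hasPathMinor 1 a t h = glued-short 1 (path-length-bound t a 0 2 h (ℕₚ.≤ᵇ⇒≤ _ _ _))
glued-hasPathMinor 2 a t h = glued-short 2 (path-length-bound t a 0 4 h (ℕₚ.≤ᵇ⇒≤ _ _ _))
glued-hasPathMinor 3 a t h = glued-drop 0 (path-length-bound t a 2 6 h (ℕₚ.≤ᵇ⇒≤ _ _ _))
glued-hasPathMinor 4 a t h = glued-drop 1 (path-length-bound t a 2 8 h (ℕₚ.≤ᵇ⇒≤ _ _ _))
glued-hasPathMinor 5 a t h = glued-drop 2 (path-length-bound t a 2 10 h (ℕₚ.≤ᵇ⇒≤ _ _ _))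
glued-hasPathMinor (suc (suc (suc (suc (suc (suc m)))))) a t h =
  glued-step a m (glued-hasPathMinor m (a + 4) t (subst (3 * t + 2 ≤_) (invariant a m) h))
  where
  invariant : ∀ a m → 2 * (6 + m) + 3 * a ≡ 2 * m + 3 * (a + 4)
  invariant = solve-∀

lemma4p4 : ∀ (t s : ℕ) → 1 ≤ t → 3 * t + 2 ≤ 2 * s →
    HasPivotMinorIso (coP-adj s) (P-adj t)
lemma4p4 t s _ h =
  HasPivotMinorIso-resp-≗₂ {p = P-adj t} coPathℕ-toℕ
    (glued-hasPathMinor s 0 t (subst (3 * t + 2 ≤_) (sym (ℕₚ.+-identityʳ (2 * s))) h))
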